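{- The map $\iota:\mathbb R\to\mathcal R$, $\iota(x)=\{(p,q)\mid p<x\text{ and }x<q\}$, is a homeomorphism from $\mathbb R$ onto the subspace of strongly maximal elements of $\mathcal R$ with the relative Scott topology. Moreover, for all $x,y\in\mathbb R$, $x\#_{\mathbb R}y$ if and only if $\iota(x)\#\iota(y)$.
   Context: We work constructively: informal set theory without excluded middle or choice. A Dedekind real is a pair $x=(L_x,U_x)$ of subsets of $\mathbb Q$ (write $p<x$ for $p\in L_x$, $x<q$ for $q\in U_x$) that is bounded, rounded ($p<x\iff\exists r\,(p<r\wedge r<x)$; $x<q\iff\exists s\,(s<q\wedge x<s)$), transitive ($p<x$, $x<q$ imply $p<q$) and located (for $p<q$, $p<x$ or $x<q$). $\mathbb R$ is the set of Dedekind reals with topology whose basic opens are $\{x\mid p<x\text{ and }x<q\}$ for $p,q\in\mathbb Q$, and $x\#_{\mathbb R}y$ iff there is $p\in\mathbb Q$ with ($x<p$ and $p<y$) or ($y<p$ and $p<x$) (reading $x<p$, $p<y$ via the cuts). Let $\mathbb Q\times_<\mathbb Q=\{(p,q)\mid p<q\}$ with $(p,q)\prec(r,s)$ iff $p<r<s<q$; $\mathcal R$ is the set of subsets of $\mathbb Q\times_<\mathbb Q$ that are $\prec$-lower sets and $\prec$-directed, ordered by inclusion (directed suprema are unions), a continuous dcpo. In a dcpo, $x\ll y$ if for every directed $S$ with $y\sqsubseteq\bigsqcup S$ some $s\in S$ has $x\sqsubseteq s$; Scott open sets are upper sets $U$ such that $\bigsqcup S\in U$ for directed $S$ implies some $s\in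 S$ lies in $U$. An element $x$ is strongly maximal if for all $u\ll v$, $u\ll x$ or there are disjoint Scott opens containing $v$ and $x$ respectively. Intrinsic apartness: $a\# b$ iff some Scott open contains exactly one of $a,b$. -}

module Defs where

open import Level using (Level; 0ℓ) renaming (suc to lsuc)
open import Data.Rational using (ℚ; _<_; _≤_)
open import Data.Rational.Properties using (<-trans; <-≤-trans; ≤-<-trans; ≤-total)
open import Data.Product using (Σ; Σ-syntax; _×_; _,_; proj₁; proj₂)
open import Data.Sum using (_⊎_; inj₁; inj₂)
open import Data.Empty using (⊥)
open import Relation.Nullary using (¬_)
open import Function.Bundles using (_⇔_)

-- Dedekind reals.  Subsets of ℚ are predicates ℚ → Set.
--   p < x  means  L p ;   x < q  means  U q.

record ℝ : Set₁ where
  field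
    L U         : ℚ → Set
    boundedL    : Σ[ p ∈ ℚ ] L p
    boundedU    : Σ[ q ∈ ℚ ] U q
    roundedL    : ∀ p → L p ⇔ (Σ[ r ∈ ℚ ] (p < r × L r))
    roundedU    : ∀ q → U q ⇔ (Σ[ s ∈ ℚ ] (s < q × U s))
    transitive  : ∀ {p q} → L p → U q → p < q
    located     : ∀ {p q} → p < q → L p ⊎ U q

open ℝ public

_≡ℝ_ : ℝ → ℝ → Set
x ≡ℝ y = (∀ p → L x p ⇔ L y p) × (∀ q → U x q ⇔ U y q)

_#ℝ_ : ℝ → ℝ → Set
x #ℝ y = Σ[ p ∈ ℚ ] ((U x p × L y p) ⊎ (U y p × L x p))

IsOpenℝ : (ℝ → Set₁) → Set₁
IsOpenℝ O = ∀ x → O x →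
  Σ[ p ∈ ℚ ] Σ[ q ∈ ℚ ] (L x p × U x q × (∀ z → L z p → U z q → O z))

-- The domain 𝓡 of lower, directed subsets of ℚ ×_< ℚ.
-- (p , q) ≺ (r , s)  iff  p < r < s < q.

record 𝓡 : Set₁ where
  field
    A        : ℚ → ℚ → Set
    A-<      : ∀ {p q} → A p q → p < q
    lower    : ∀ {p q r s} → A r s → p < r → s < q → A p q
    inhabited : Σ[ p ∈ ℚ ] Σ[ q ∈ ℚ ] A p q
    directed : ∀ {p q r s} → A p q → A r s →
               Σ[ t ∈ ℚ ] Σ[ u ∈ ℚ ]
                 (A t u × (p < t × u < q) × (r < t × u < s))

open 𝓡 public

_⊑_ : 𝓡 → 𝓡 → Set
x ⊑ y = ∀ p q → A x p q → A y p q

IsDirected : {I : Set} → (I → 𝓡) → Set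
IsDirected {I} α = I × (∀ i j → Σ[ k ∈ I ] (α i ⊑ α k × α j ⊑ α k))

IsUnion : {I : Set} → (I → 𝓡) → 𝓡 → Set
IsUnion {I} α z = ∀ p q → A z p q ⇔ (Σ[ i ∈ I ] A (α i) p q)

_≪_ : 𝓡 → 𝓡 → Set₁
x ≪ y = ∀ (I : Set) (α : I → 𝓡) → IsDirected α →
        (∀ p q → A y p q → Σ[ i ∈ I ] A (α i) p q) →
        Σ[ i ∈ I ] (x ⊑ α i)

IsScottOpen : (𝓡 → Set₁) → Set₁
IsScottOpen U =
  (∀ x y → x ⊑ y → U x → U y) ×
  (∀ (I : Set) (α : I → 𝓡) → IsDirected α → ∀ z → IsUnion α z → U z →
     Σ[ i ∈ I ] U (α i))

StronglyMaximal : 𝓡 → Set₂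
StronglyMaximal x = ∀ u v → u ≪ v →
  (u ≪ x) ⊎
  (Σ[ U ∈ (𝓡 → Set₁) ] Σ[ V ∈ (𝓡 → Set₁) ]
     (IsScottOpen U × IsScottOpen V × U v × V x × (∀ z → U z → V z → ⊥)))

_#_ : 𝓡 → 𝓡 → Set₂
a # b = Σ[ U ∈ (𝓡 → Set₁) ]
          (IsScottOpen U × ((U a × ¬ U b) ⊎ (U b × ¬ U a)))

_≈_ : 𝓡 → 𝓡 → Set
x ≈ y = x ⊑ y × y ⊑ x

ι : ℝ → 𝓡
ι x = record
  { A = λ p q → L x p × U x q
  ; A-< = λ (lp , uq) → transitive x lp uq
  ; lower = λ {p} {q} {r} {s} (lr , us) p<r s<q →
      Equivalence.from (roundedL x p) (r , p<r , lr) ,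
      Equivalence.from (roundedU x q) (s , s<q , us)
  ; inhabited = proj₁ (boundedL x) , proj₁ (boundedU x) ,
                proj₂ (boundedL x) , proj₂ (boundedU x)
  ; directed = dir
  }
  where
  open import Function.Bundles using (module Equivalence)
  dir : ∀ {p q r s} → L x p × U x q → L x r × U x s →
        Σ[ t ∈ ℚ ] Σ[ u ∈ ℚ ]
          ((L x t × U x u) × (p < t × u < q) × (r < t × u < s))
  dir {p} {q} {r} {s} (lp , uq) (lr , us)
    with Equivalence.to (roundedL x p) lp | Equivalence.to (roundedL x r) lr
       | Equivalence.to (roundedU x q) uq | Equivalence.to (roundedU x s) us
  ... | (p' , p<p' , lp') | (r' , r<r' , lr') | (q' , q'<q , uq') | (s' , s'<s , us')
    with ≤-total p' r' | ≤-total q' s'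
  ... | inj₁ p'≤r' | inj₁ q'≤s' =
        r' , q' , (lr' , uq') , (<-≤-trans p<p' p'≤r' , q'<q) , (r<r' , ≤-<-trans q'≤s' s'<s)
  ... | inj₁ p'≤r' | inj₂ s'≤q' =
        r' , s' , (lr' , us') , (<-≤-trans p<p' p'≤r' , ≤-<-trans s'≤q' q'<q) , (r<r' , s'<s)
  ... | inj₂ r'≤p' | inj₁ q'≤s' =
        p' , q' , (lp' , uq') , (p<p' , q'<q) , (<-≤-trans r<r' r'≤p' , ≤-<-trans q'≤s' s'<s)
  ... | inj₂ r'≤p' | inj₂ s'≤q' =
        p' , s' , (lp' , us') , (p<p' , ≤-<-trans s'≤q' q'<q) , (<-≤-trans r<r' r'≤p' , s'<s)

-- An element of 𝓡 is a directed family of rational intervals, and it is the directed union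
-- of the closed intervals it contains; hence u ≪ v iff u lies below one such interval, and a
-- Scott open containing v already contains one of them.  Strong maximality of y, tested on
-- u = [p, q] ≪ v = [m, m] with p < m < q, says that either y has an approximant starting
-- at or above p, or y is Scott-separated from the point m, and then some approximant of y
-- lies on one side of m.  So the approximants of a strongly maximal element form a located
-- cut, i.e. a real; conversely, locatedness of a real x makes ι x strongly maximal.  Scott
-- opens meet ι(ℝ) in sets generated by intervals, which gives the homeomorphism and the
-- agreement of the two apartness relations.
module Submission where

open import Defs
open import Data.Product using (Σ; Σ-syntax; _×_; _,_; proj₁; proj₂)
open import Data.Sum using (_⊎_; inj₁; inj₂; [_,_]′)
open import Data.Empty using (⊥; ⊥-elim)
open import Function.Bundles using (_⇔_; mk⇔; module Equivalence)
open import Level using (Lift; lift)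
open import Relation.Nullary using (¬_; yes; no)
open import Relation.Nullary.Decidable using (recompute)
open import Relation.Binary.PropositionalEquality using (subst)
open import Data.Rational using (ℚ; _<_; _≤_; _+_; -_; _-_; _⊔_; 1ℚ)
open import Data.Rational.Properties
  using (<-trans; <-≤-trans; ≤-<-trans; ≤-total; <⇒≤; ≮⇒≥; <-asym; <-dense; ≤-refl;
         _≤?_; ≰⇒>; +-identityʳ; +-monoʳ-<; positive⁻¹; negative⁻¹;
         p≤p⊔q; p≤q⊔p; ⊔-lub)

open Equivalence using (to)

p<p+1 : ∀ p → p < p + 1ℚ
p<p+1 p = subst (_< p + 1ℚ) (+-identityʳ p) (+-monoʳ-< p (positive⁻¹ 1ℚ))

p-1<p : ∀ p → p - 1ℚ < p
p-1<p p = subst (p - 1ℚ <_) (+-identityʳ p) (+-monoʳ-< p (negative⁻¹ (- 1ℚ)))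

dense-above-both : ∀ {a c m} → a < m → c < m → Σ[ t ∈ ℚ ] (a < t × c < t × t < m)
dense-above-both {a} {c} a<m c<m with ≤-total a c
... | inj₁ a≤c = let t , c<t , t<m = <-dense c<m in t , ≤-<-trans a≤c c<t , c<t , t<m
... | inj₂ c≤a = let t , a<t , t<m = <-dense a<m in t , a<t , ≤-<-trans c≤a a<t , t<m

dense-below-both : ∀ {b d m} → m < b → m < d → Σ[ u ∈ ℚ ] (u < b × u < d × m < u)
dense-below-both {b} {d} m<b m<d with ≤-total b d
... | inj₁ b≤d = let u , m<u , u<b = <-dense m<b in u , u<b , <-≤-trans u<b b≤d , m<u
... | inj₂ d≤b = let u , m<u , u<d = <-dense m<d in u , <-≤-trans u<d d≤b , u<d , m<u

intervals-apart-or-meet : ∀ {a b c d} → a ≤ b → c ≤ d →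
  d ≤ a ⊎ b ≤ c ⊎ Σ[ m ∈ ℚ ] (a ≤ m × m ≤ b × c ≤ m × m ≤ d)
intervals-apart-or-meet {a} {b} {c} {d} a≤b c≤d with d ≤? a | b ≤? c
... | yes d≤a | _       = inj₁ d≤a
... | no _    | yes b≤c = inj₂ (inj₁ b≤c)
... | no d≰a  | no b≰c  =
  inj₂ (inj₂ (a ⊔ c , p≤p⊔q a c , ⊔-lub a≤b (<⇒≤ (≰⇒> b≰c)) ,
                      p≤q⊔p a c , ⊔-lub (<⇒≤ (≰⇒> d≰a)) c≤d))

A-weakenˡ : ∀ y {p r s} → A y r s → p ≤ r → A y p s
A-weakenˡ y rs∈y p≤r =
  let t , u , tu∈y , (r<t , u<s) , _ = directed y rs∈y rs∈y
  in lower y tu∈y (≤-<-trans p≤r r<t) u<s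

A-weakenʳ : ∀ y {r s q} → A y r s → s ≤ q → A y r q
A-weakenʳ y rs∈y s≤q =
  let t , u , tu∈y , (r<t , u<s) , _ = directed y rs∈y rs∈y
  in lower y tu∈y r<t (<-≤-trans u<s s≤q)

-- The closed interval [p, q]; the proof of p ≤ q is irrelevant, since ⊑ and ≪ unfold
-- to statements that never determine it.
interval : (p q : ℚ) → .(p ≤ q) → 𝓡
interval p q p≤q = record
  { A = λ a b → a < p × q < b
  ; A-< = λ (a<p , q<b) → <-trans (<-≤-trans a<p (recompute (p ≤? q) p≤q)) q<b
  ; lower = λ (r<p , q<s) p'<r s<q' → <-trans p'<r r<p , <-trans q<s s<q'
  ; inhabited = p - 1ℚ , q + 1ℚ , p-1<p p , p<p+1 q
  ; directed = λ (a<p , q<b) (c<p , q<d) →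
      let t , a<t , c<t , t<p = dense-above-both a<p c<p
          u , u<b , u<d , q<u = dense-below-both q<b q<d
      in t , u , (t<p , q<u) , (a<t , u<b) , (c<t , u<d)
  }

point : ℚ → 𝓡
point m = interval m m ≤-refl

interval⊑ : ∀ x {p q} .(p≤q : p ≤ q) → A x p q → interval p q p≤q ⊑ x
interval⊑ x _ pq∈x a b (a<p , q<b) = lower x pq∈x a<p q<b

interval⊑interval⇒≤ : ∀ {p q a b} .{p≤q : p ≤ q} .{a≤b : a ≤ b} →
  interval p q p≤q ⊑ interval a b a≤b → p ≤ a
interval⊑interval⇒≤ {q = q} [p,q]⊑[a,b] = ≮⇒≥ λ a<p →
  let c , a<c , c<p = <-dense a<p
  in <-asym a<c (proj₁ ([p,q]⊑[a,b] c (q + 1ℚ) (c<p , p<p+1 q)))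

interval⊑point : ∀ {a b m} .{a≤b : a ≤ b} → a ≤ m → m ≤ b → interval a b a≤b ⊑ point m
interval⊑point a≤m m≤b e f (e<a , b<f) = <-≤-trans e<a a≤m , ≤-<-trans m≤b b<f

Pairs : 𝓡 → Set
Pairs v = Σ[ p ∈ ℚ ] Σ[ q ∈ ℚ ] A v p q

intervalsOf : (v : 𝓡) → Pairs v → 𝓡
intervalsOf v (p , q , pq∈v) = interval p q (<⇒≤ (A-< v pq∈v))

intervalsOf-directed : ∀ v → IsDirected (intervalsOf v)
intervalsOf-directed v = inhabited v , λ (p , q , pq∈v) (r , s , rs∈v) →
  let t , u , tu∈v , (p<t , u<q) , (r<t , u<s) = directed v pq∈v rs∈v
      [t,u] = intervalsOf v (t , u , tu∈v)
  in (t , u , tu∈v) , interval⊑ [t,u] (<⇒≤ (A-< v pq∈v)) (p<t , u<q)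
                    , interval⊑ [t,u] (<⇒≤ (A-< v rs∈v)) (r<t , u<s)

intervalsOf-cover : ∀ v p q → A v p q → Σ[ i ∈ Pairs v ] A (intervalsOf v i) p q
intervalsOf-cover v p q pq∈v =
  let t , u , tu∈v , p<t,u<q , _ = directed v pq∈v pq∈v in (t , u , tu∈v) , p<t,u<q

intervalsOf-union : ∀ v → IsUnion (intervalsOf v) v
intervalsOf-union v p q =
  mk⇔ (intervalsOf-cover v p q)
      (λ ((a , b , ab∈v) , pq∈[a,b]) → interval⊑ v (<⇒≤ (A-< v ab∈v)) ab∈v p q pq∈[a,b])

≪⇒⊑interval : ∀ u v → u ≪ v → Σ[ i ∈ Pairs v ] (u ⊑ intervalsOf v i)
≪⇒⊑interval u v u≪v = u≪v (Pairs v) (intervalsOf v) (intervalsOf-directed v) (intervalsOf-cover v)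

interval≪ : ∀ x {p q} .(p≤q : p ≤ q) → A x p q → interval p q p≤q ≪ x
interval≪ x p≤q pq∈x I α _ cover =
  let t , u , tu∈x , (p<t , u<q) , _ = directed x pq∈x pq∈x
      i , tu∈αi = cover t u tu∈x
  in i , interval⊑ (α i) p≤q (lower (α i) tu∈αi p<t u<q)

⊑-≪-trans : ∀ {u w x} → u ⊑ w → w ≪ x → u ≪ x
⊑-≪-trans u⊑w w≪x I α dir cover =
  let i , w⊑αi = w≪x I α dir cover in i , λ a b ab∈u → w⊑αi a b (u⊑w a b ab∈u)

upward : ∀ {U x y} → IsScottOpen U → x ⊑ y → U x → U y
upward U-open = proj₁ U-open _ _

ScottOpen-∋-interval : ∀ {U v} → IsScottOpen U → U v →
  Σ[ i ∈ Pairs v ] U (intervalsOf v i)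
ScottOpen-∋-interval {v = v} U-open Uv =
  proj₂ U-open (Pairs v) (intervalsOf v) (intervalsOf-directed v) v (intervalsOf-union v) Uv

HasPair : (ℚ → ℚ → Set₁) → 𝓡 → Set₁
HasPair P z = Σ[ a ∈ ℚ ] Σ[ b ∈ ℚ ] (A z a b × P a b)

HasPair-isScottOpen : ∀ P → IsScottOpen (HasPair P)
HasPair-isScottOpen P =
    (λ x y x⊑y (a , b , ab∈x , Pab) → a , b , x⊑y a b ab∈x , Pab)
  , λ _ _ _ z z≡⋃α (a , b , ab∈z , Pab) →
      let i , ab∈αi = to (z≡⋃α a b) ab∈z in i , a , b , ab∈αi , Pab

Below Above : ℚ → 𝓡 → Set₁
Below c = HasPair (λ a b → Lift _ (b < c))
Above c = HasPair (λ a b → Lift _ (c < a))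

Below-Above-disjoint : ∀ {c} z → Below c z → Above c z → ⊥
Below-Above-disjoint z (a , b , ab∈z , lift b<c) (a′ , b′ , ab′∈z , lift c<a′) =
  let t , u , tu∈z , (_ , u<b) , (a′<t , _) = directed z ab∈z ab′∈z
  in <-asym (<-trans b<c (<-trans c<a′ (<-trans a′<t (A-< z tu∈z)))) u<b

∈⇒Above : ∀ v {a b} → A v a b → Above a v
∈⇒Above v ab∈v = let t , u , tu∈v , (a<t , _) , _ = directed v ab∈v ab∈v in t , u , tu∈v , lift a<t

∈⇒Below : ∀ v {a b} → A v a b → Below b v
∈⇒Below v ab∈v = let t , u , tu∈v , (_ , u<b) , _ = directed v ab∈v ab∈v in t , u , tu∈v , lift u<b

ScottSeparated : 𝓡 → 𝓡 → Set₂
ScottSeparated v x = Σ[ U ∈ (𝓡 → Set₁) ] Σ[ V ∈ (𝓡 → Set₁) ]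
  (IsScottOpen U × IsScottOpen V × U v × V x × (∀ z → U z → V z → ⊥))

Above-Below-separated : ∀ {c v x} → Above c v → Below c x → ScottSeparated v x
Above-Below-separated {c} v>c x<c =
  Above c , Below c , HasPair-isScottOpen _ , HasPair-isScottOpen _ , v>c , x<c ,
  λ z z>c z<c → Below-Above-disjoint z z<c z>c

Below-Above-separated : ∀ {c v x} → Below c v → Above c x → ScottSeparated v x
Below-Above-separated {c} v<c x>c =
  Below c , Above c , HasPair-isScottOpen _ , HasPair-isScottOpen _ , v<c , x>c ,
  Below-Above-disjoint

ι-Below : ∀ x {c} → U x c → Below c (ι x)
ι-Below x x<c = ∈⇒Below (ι x) (proj₂ (boundedL x) , x<c)

ι-Above : ∀ x {c} → L x c → Above c (ι x)
ι-Above x c<x = ∈⇒Above (ι x) (c<x , proj₂ (boundedU x))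

¬ι-Below : ∀ x {c} → L x c → ¬ Below c (ι x)
¬ι-Below x c<x (_ , b , (_ , x<b) , lift b<c) = <-asym b<c (transitive x c<x x<b)

-- Given u ≪ v, some (p, q) ∈ v has u ⊑ [p, q]; for (t, w) ∈ v inside (p, q), locating x
-- at p < t and at w < q either puts (p, q) in ι x or separates v from ι x at t or at w.
ι-stronglyMaximal : ∀ x → StronglyMaximal (ι x)
ι-stronglyMaximal x u v u≪v with ≪⇒⊑interval u v u≪v
... | (p , q , pq∈v) , u⊑[p,q] with directed v pq∈v pq∈v
... | t , w , tw∈v , (p<t , w<q) , _ with located x p<t | located x w<q
... | inj₂ x<t | _       = inj₂ (Above-Below-separated (∈⇒Above v tw∈v) (ι-Below x x<t))
... | inj₁ _   | inj₁ w<x = inj₂ (Below-Above-separated (∈⇒Below v tw∈v) (ι-Above x w<x))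
... | inj₁ p<x | inj₂ x<q =
  inj₁ (⊑-≪-trans {u} {intervalsOf v (p , q , pq∈v)} {ι x} u⊑[p,q]
         (interval≪ (ι x) (<⇒≤ (A-< v pq∈v)) (p<x , x<q)))

lowerCut upperCut : 𝓡 → ℚ → Set
lowerCut y p = Σ[ q ∈ ℚ ] A y p q
upperCut y q = Σ[ p ∈ ℚ ] A y p q

IsLocated : 𝓡 → Set
IsLocated y = ∀ {p q} → p < q → lowerCut y p ⊎ upperCut y q

interval≪⇒lowerCut : ∀ y {p q} .(p≤q : p ≤ q) → interval p q p≤q ≪ y → lowerCut y p
interval≪⇒lowerCut y {p} {q} p≤q [p,q]≪y =
  let (a , b , ab∈y) , [p,q]⊑[a,b] = ≪⇒⊑interval (interval p q p≤q) y [p,q]≪y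
  in b , A-weakenˡ y ab∈y (interval⊑interval⇒≤ {p≤q = p≤q} {a≤b = <⇒≤ (A-< y ab∈y)} [p,q]⊑[a,b])

-- The opens separating a rational point from y contain intervals [a, b] ∋ m and [c, d]
-- approximating y; these cannot overlap, so [c, d] lies on one side of m.
point-separated⇒located : ∀ y {p m q} → p < m → m < q → ScottSeparated (point m) y →
  lowerCut y p ⊎ upperCut y q
point-separated⇒located y {p} {m} {q} p<m m<q (U , V , U-open , V-open , Um , Vy , U∩V=∅)
  with ScottOpen-∋-interval U-open Um | ScottOpen-∋-interval V-open Vy
... | (a , b , a<m , m<b) , U[a,b] | (c , d , cd∈y) , V[c,d]
  with intervals-apart-or-meet (<⇒≤ (<-trans a<m m<b)) (<⇒≤ (A-< y cd∈y))
... | inj₁ d≤a = inj₂ (c , A-weakenʳ y cd∈y (<⇒≤ (≤-<-trans d≤a (<-trans a<m m<q))))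
... | inj₂ (inj₁ b≤c) = inj₁ (d , A-weakenˡ y cd∈y (<⇒≤ (<-trans p<m (<-≤-trans m<b b≤c))))
... | inj₂ (inj₂ (n , a≤n , n≤b , c≤n , n≤d)) =
  ⊥-elim (U∩V=∅ (point n)
    (upward {U} U-open (interval⊑point {a≤b = <⇒≤ (<-trans a<m m<b)} a≤n n≤b) U[a,b])
    (upward {V} V-open (interval⊑point {a≤b = <⇒≤ (A-< y cd∈y)} c≤n n≤d) V[c,d]))

StronglyMaximal⇒IsLocated : ∀ y → StronglyMaximal y → IsLocated y
StronglyMaximal⇒IsLocated y sm {p} {q} p<q =
  let m , p<m , m<q = <-dense p<q
      p≤q = <⇒≤ p<q
  in [ (λ [p,q]≪y → inj₁ (interval≪⇒lowerCut y p≤q [p,q]≪y))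
     , point-separated⇒located y p<m m<q
     ]′ (sm (interval p q p≤q) (point m) (interval≪ (point m) p≤q (p<m , m<q)))

cut : (y : 𝓡) → IsLocated y → ℝ
cut y y-located = record
  { L = lowerCut y
  ; U = upperCut y
  ; boundedL = let p , q , pq∈y = inhabited y in p , q , pq∈y
  ; boundedU = let p , q , pq∈y = inhabited y in q , p , pq∈y
  ; roundedL = λ p → mk⇔
      (λ (q , pq∈y) → let t , u , tu∈y , (p<t , _) , _ = directed y pq∈y pq∈y in t , p<t , u , tu∈y)
      (λ (r , p<r , q , rq∈y) → q , A-weakenˡ y rq∈y (<⇒≤ p<r))
  ; roundedU = λ q → mk⇔
      (λ (p , pq∈y) → let t , u , tu∈y , (_ , u<q) , _ = directed y pq∈y pq∈y in u , u<q , t , tu∈y)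
      (λ (s , s<q , p , ps∈y) → p , A-weakenʳ y ps∈y (<⇒≤ s<q))
  ; transitive = λ (_ , pb∈y) (_ , aq∈y) →
      let t , u , tu∈y , (p<t , _) , (_ , u<q) = directed y pb∈y aq∈y
      in <-trans p<t (<-trans (A-< y tu∈y) u<q)
  ; located = y-located
  }

ι-cut : ∀ y (y-located : IsLocated y) → ι (cut y y-located) ≈ y
ι-cut y _ =
    (λ p q ((_ , pb∈y) , (_ , aq∈y)) →
       let t , u , tu∈y , (p<t , _) , (_ , u<q) = directed y pb∈y aq∈y
       in lower y tu∈y p<t u<q)
  , (λ p q pq∈y → (q , pq∈y) , (p , pq∈y))

StronglyMaximal⇒∈ι-image : ∀ y → StronglyMaximal y → Σ[ x ∈ ℝ ] (ι x ≈ y)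
StronglyMaximal⇒∈ι-image y sm =
  let y-located = StronglyMaximal⇒IsLocated y sm in cut y y-located , ι-cut y y-located

ι-injective : ∀ x x′ → ι x ≈ ι x′ → x ≡ℝ x′
ι-injective x x′ (ιx⊑ιx′ , ιx′⊑ιx) =
    (λ p → mk⇔ (λ p<x → proj₁ (ιx⊑ιx′ p _ (p<x , proj₂ (boundedU x))))
               (λ p<x′ → proj₁ (ιx′⊑ιx p _ (p<x′ , proj₂ (boundedU x′)))))
  , (λ q → mk⇔ (λ x<q → proj₂ (ιx⊑ιx′ _ q (proj₂ (boundedL x) , x<q)))
               (λ x′<q → proj₂ (ιx′⊑ιx _ q (proj₂ (boundedL x′) , x′<q))))

ι-continuous : ∀ U → IsScottOpen U → IsOpenℝ (λ x → U (ι x))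
ι-continuous U U-open x Uιx =
  let (p , q , p<x , x<q) , U[p,q] = ScottOpen-∋-interval {U} U-open Uιx
  in p , q , p<x , x<q , λ z p<z z<q →
       upward {U} U-open (interval⊑ (ι z) (<⇒≤ (transitive x p<x x<q)) (p<z , z<q)) U[p,q]

BasicOpen⊆ : (ℝ → Set₁) → ℚ → ℚ → Set₁
BasicOpen⊆ O p q = ∀ z → L z p → U z q → O z

ι-open : ∀ O → IsOpenℝ O →
  Σ[ U ∈ (𝓡 → Set₁) ] (IsScottOpen U ×
    (∀ y → StronglyMaximal y → ((Σ[ x ∈ ℝ ] (O x × ι x ≈ y)) ⇔ U y)))
ι-open O O-open = HasPair (BasicOpen⊆ O) , HasPair-isScottOpen (BasicOpen⊆ O) , λ y sm → mk⇔
  (λ (x , Ox , ιx⊑y , _) →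
     let p , q , p<x , x<q , pq⊆O = O-open x Ox in p , q , ιx⊑y p q (p<x , x<q) , pq⊆O)
  (λ (p , q , pq∈y , pq⊆O) →
     let x , ιx≈y = StronglyMaximal⇒∈ι-image y sm
         p<x , x<q = proj₂ ιx≈y p q pq∈y
     in x , pq⊆O x p<x x<q , ιx≈y)

#ℝ-sym : ∀ x y → x #ℝ y → y #ℝ x
#ℝ-sym x y (p , inj₁ h) = p , inj₂ h
#ℝ-sym x y (p , inj₂ h) = p , inj₁ h

ScottOpen-separates⇒#ℝ : ∀ {U} x y → IsScottOpen U → U (ι x) → ¬ U (ι y) → x #ℝ y
ScottOpen-separates⇒#ℝ {U} x y U-open Uιx ¬Uιy with ι-continuous U U-open x Uιx
... | p , q , p<x , x<q , pq⊆U with to (roundedL x p) p<x | to (roundedU x q) x<q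
... | r , p<r , r<x | s , s<q , x<s with located y p<r | located y s<q
... | inj₂ y<r | _        = r , inj₂ (y<r , r<x)
... | inj₁ _   | inj₁ s<y = s , inj₁ (x<s , s<y)
... | inj₁ p<y | inj₂ y<q = ⊥-elim (¬Uιy (pq⊆U y p<y y<q))

#ℝ⇔ι-# : ∀ x y → (x #ℝ y) ⇔ (ι x # ι y)
#ℝ⇔ι-# x y = mk⇔
  (λ where
     (p , inj₁ (x<p , p<y)) → Below p , HasPair-isScottOpen _ , inj₁ (ι-Below x x<p , ¬ι-Below y p<y)
     (p , inj₂ (y<p , p<x)) → Below p , HasPair-isScottOpen _ , inj₂ (ι-Below y y<p , ¬ι-Below x p<x))
  (λ where
     (U , U-open , inj₁ (Uιx , ¬Uιy)) → ScottOpen-separates⇒#ℝ x y U-open Uιx ¬Uιy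
     (U , U-open , inj₂ (Uιy , ¬Uιx)) → #ℝ-sym y x (ScottOpen-separates⇒#ℝ y x U-open Uιy ¬Uιx))

theorem7p18 :
    (∀ x → StronglyMaximal (ι x))
  × (∀ y → StronglyMaximal y → Σ[ x ∈ ℝ ] (ι x ≈ y))
  × (∀ x x′ → ι x ≈ ι x′ → x ≡ℝ x′)
  × (∀ U → IsScottOpen U → IsOpenℝ (λ x → U (ι x)))
  × (∀ O → IsOpenℝ O →
       Σ[ U ∈ (𝓡 → Set₁) ] (IsScottOpen U ×
         (∀ y → StronglyMaximal y → ((Σ[ x ∈ ℝ ] (O x × ι x ≈ y)) ⇔ U y))))
  × (∀ x y → (x #ℝ y) ⇔ (ι x # ι y))
theorem7p18 =
    ι-stronglyMaximal
  , StronglyMaximal⇒∈ι-image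
  , ι-injective
  , ι-continuous
  , ι-open
  , #ℝ⇔ι-#
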